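{- Let $k,m$ be positive integers. If a finite graph $G$ is strongly $k$-choosable, then it is strongly $km$-choosable as well.
   Context: A graph $H=(V,E)$ is $k$-choosable if for every family of sets $\{S(v):v\in V\}$ with $|S(v)|=k$ there is a proper vertex coloring assigning to each $v$ a color from $S(v)$. A graph $G=(V,E)$ is strongly $k$-choosable if every graph obtained from $G$ by adding to it (the edges of) a union of pairwise vertex-disjoint cliques, each of size at most $k$, on the vertex set $V$ is $k$-choosable. -}

module Defs where

open import Data.Nat using (ℕ; _≤_)
open import Data.Fin using (Fin)
open import Data.List using (List; length; filter; allFin)
open import Data.List.Membership.Propositional using (_∈_)
open import Data.List.Relation.Unary.Unique.Propositional using (Unique)
open import Data.Product using (Σ; _×_)
open import Data.Sum using (_⊎_)
open import Relation.Nullary using (¬_)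
open import Relation.Binary.PropositionalEquality using (_≡_; _≢_)
import Data.Nat as ℕ

record Graph (n : ℕ) : Set₁ where
  field
    Adj    : Fin n → Fin n → Set
    sym    : ∀ {u v} → Adj u v → Adj v u
    irrefl : ∀ {v} → ¬ Adj v v
open Graph public

-- A list assignment with lists of size k: each S v is a list of k distinct colours.
-- (Colours are natural numbers; with finitely many vertices this is no loss.)
IsKAssignment : ∀ {n} → ℕ → (Fin n → List ℕ) → Set
IsKAssignment {n} k S = ∀ (v : Fin n) → Unique (S v) × length (S v) ≡ k

ProperListColouring : ∀ {n} → (Fin n → Fin n → Set) → (Fin n → List ℕ) → (Fin n → ℕ) → Set
ProperListColouring {n} Adj S c =
  (∀ v → c v ∈ S v) × (∀ u v → Adj u v → c u ≢ c v)

Choosable : ∀ {n} → (Fin n → Fin n → Set) → ℕ → Set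
Choosable {n} Adj k =
  ∀ (S : Fin n → List ℕ) → IsKAssignment k S →
    Σ (Fin n → ℕ) (ProperListColouring Adj S)

-- A union of pairwise vertex-disjoint cliques of size ≤ k, covering V (vertices
-- not in any clique are singleton cliques, which add no edges): given by a
-- block labelling p, each block having at most k vertices.
BlocksAtMost : ∀ {n} → ℕ → (Fin n → ℕ) → Set
BlocksAtMost {n} k p =
  ∀ (i : ℕ) → length (filter (λ v → p v ℕ.≟ i) (allFin n)) ≤ k

AddCliques : ∀ {n} → Graph n → (Fin n → ℕ) → Fin n → Fin n → Set
AddCliques G p u v = Adj G u v ⊎ (u ≢ v × p u ≡ p v)

StronglyChoosable : ∀ {n} → Graph n → ℕ → Set
StronglyChoosable {n} G k =
  ∀ (p : Fin n → ℕ) → BlocksAtMost k p → Choosable (AddCliques G p) k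

module Submission where

-- Given blocks p of size ≤ km and lists S of km colours, we build a k-refinement: a finer
-- labelling with blocks of ≤ k vertices and k-element sublists of S that are disjoint for
-- vertices of a common p-block with different new labels.  Strong k-choosability colours
-- G + cliques(new labels) from the sublists, which is a proper colouring of G + cliques(p) from S.
--
-- A peeling step splits every block B at a colour
-- threshold t into U (|U| ≤ (m-1)k, keeping the colours ≥ t) and B ∖ U (|B ∖ U| ≤ k, keeping
-- k colours < t), and refines U recursively.  The threshold is found by a discrete
-- intermediate value argument, and U by an intermediate-size lemma for nested vertex sets.

open import Defs hiding (sym)
open import Data.Nat using (ℕ; zero; suc; _+_; _*_; _≤_; _<_; z≤n; s≤s;
  _<ᵇ_; _≤ᵇ_; _≡ᵇ_; NonZero; >-nonZero⁻¹)
open import Data.Nat.Properties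
open import Data.Nat.ListAction using (sum)
open import Data.Bool using (Bool; true; false; T; _∧_; not; if_then_else_)
open import Data.Bool.Properties using (T-∧; T-≡; T-not-≡)
open import Data.Empty using (⊥-elim)
open import Data.Unit using (tt)
open import Data.Fin using (Fin) renaming (zero to fzero; suc to fsuc)
open import Data.List using (List; []; _∷_; length; filter; take; map; tabulate; allFin)
open import Data.List.Properties using (filter-all; length-take)
open import Data.List.Membership.Propositional using (_∈_)
open import Data.List.Membership.Propositional.Properties using (∈-map⁺; ∈-allFin; ∈-filter⁻)
open import Data.List.Relation.Binary.Subset.Propositional using () renaming (_⊆_ to _⊆ˡ_)
open import Data.List.Relation.Binary.Disjoint.Propositional using (Disjoint)
import Data.List.Relation.Binary.Sublist.Propositional as Sublist
open import Data.List.Relation.Binary.Sublist.Propositional.Properties using (take-⊆)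
import Data.List.Relation.Unary.All as All
open import Data.List.Relation.Unary.Any using (here; there)
open import Data.List.Relation.Unary.Unique.Propositional using (Unique; []; _∷_)
import Data.List.Relation.Unary.Unique.Propositional.Properties as Unique
open import Data.Product using (Σ; ∃; _×_; _,_; proj₁; proj₂)
open import Data.Sum using (_⊎_; inj₁; inj₂; [_,_]′)
open import Function using (_∘_; id; Equivalence)
open import Relation.Nullary using (¬_; does; yes; no; contradiction)
open import Relation.Unary using (Pred; Decidable)
open import Relation.Unary.Properties using (∁?)
open import Relation.Binary.PropositionalEquality using (_≡_; _≢_; refl; cong; sym; trans; subst; subst₂)

∧-intro : ∀ {a b} → T a → T b → T (a ∧ b)
∧-intro ta tb = Equivalence.from T-∧ (ta , tb)

∧-elim : ∀ {a b} → T (a ∧ b) → T a × T b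
∧-elim = Equivalence.to T-∧

not-intro : ∀ {a} → ¬ T a → T (not a)
not-intro {true}  ¬a = ¬a tt
not-intro {false} _  = tt

not-elim : ∀ {a} → T (not a) → ¬ T a
not-elim {true} ()

T-true : ∀ {x} → x ≡ true → T x
T-true = Equivalence.from T-≡

¬T-false : ∀ {x} → x ≡ false → ¬ T x
¬T-false = not-elim ∘ Equivalence.from T-not-≡

VertexSet : ℕ → Set
VertexSet n = Fin n → Bool

_⊆ᵛ_ : ∀ {n} → VertexSet n → VertexSet n → Set
A ⊆ᵛ B = ∀ v → T (A v) → T (B v)

⊆ᵛ-refl : ∀ {n} {A : VertexSet n} → A ⊆ᵛ A
⊆ᵛ-refl v a = a

_∖_ : ∀ {n} → VertexSet n → VertexSet n → VertexSet n
(B ∖ A) v = B v ∧ not (A v)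

count : ∀ {n} → VertexSet n → ℕ
count {zero}  A = 0
count {suc n} A = if A fzero then suc (count (A ∘ fsuc)) else count (A ∘ fsuc)

count-head : ∀ {n} (A : VertexSet (suc n)) → A fzero ≡ true → count A ≡ suc (count (A ∘ fsuc))
count-head A head rewrite head = refl

count-mono : ∀ {n} (A B : VertexSet n) → A ⊆ᵛ B → count A ≤ count B
count-mono {zero}  A B A⊆B = z≤n
count-mono {suc n} A B A⊆B with A fzero | B fzero | A⊆B fzero
... | false | false | _   = count-mono (A ∘ fsuc) (B ∘ fsuc) (A⊆B ∘ fsuc)
... | false | true  | _   = m≤n⇒m≤1+n (count-mono (A ∘ fsuc) (B ∘ fsuc) (A⊆B ∘ fsuc))
... | true  | true  | _   = s≤s (count-mono (A ∘ fsuc) (B ∘ fsuc) (A⊆B ∘ fsuc))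
... | true  | false | a⇒b = ⊥-elim (a⇒b tt)

count-none : ∀ {n} (A : VertexSet n) → (∀ v → ¬ T (A v)) → count A ≡ 0
count-none {zero}  A none = refl
count-none {suc n} A none with A fzero | none fzero
... | false | _ = count-none (A ∘ fsuc) (none ∘ fsuc)
... | true  | a = ⊥-elim (a tt)

count-complement : ∀ {n} (A B : VertexSet n) → A ⊆ᵛ B → count A + count (B ∖ A) ≤ count B
count-complement {zero}  A B A⊆B = z≤n
count-complement {suc n} A B A⊆B with A fzero | B fzero | A⊆B fzero
... | false | false | _   = count-complement (A ∘ fsuc) (B ∘ fsuc) (A⊆B ∘ fsuc)
... | false | true  | _   = ≤-trans (≤-reflexive (+-suc (count (A ∘ fsuc)) _))
                                    (s≤s (count-complement (A ∘ fsuc) (B ∘ fsuc) (A⊆B ∘ fsuc)))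
... | true  | true  | _   = s≤s (count-complement (A ∘ fsuc) (B ∘ fsuc) (A⊆B ∘ fsuc))
... | true  | false | a⇒b = ⊥-elim (a⇒b tt)

count-tabulate : ∀ {a p} {X : Set a} {P : Pred X p} (P? : Decidable P) {n} (f : Fin n → X) →
                 length (filter P? (tabulate f)) ≡ count (λ v → does (P? (f v)))
count-tabulate P? {zero}  f = refl
count-tabulate P? {suc n} f with does (P? (f fzero))
... | true  = cong suc (count-tabulate P? (f ∘ fsuc))
... | false = count-tabulate P? (f ∘ fsuc)

Sandwiched : ∀ {n} → VertexSet n → VertexSet n → ℕ → Set
Sandwiched {n} F G r = Σ (VertexSet n) λ H → F ⊆ᵛ H × H ⊆ᵛ G × count H ≡ r

cons : ∀ {n} → Bool → VertexSet n → VertexSet (suc n)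
cons b H fzero    = b
cons b H (fsuc v) = H v

⊆ᵛ-cons : ∀ {n} {F : VertexSet (suc n)} {b H} → (T (F fzero) → T b) → (F ∘ fsuc) ⊆ᵛ H → F ⊆ᵛ cons b H
⊆ᵛ-cons head tail fzero    = head
⊆ᵛ-cons head tail (fsuc v) = tail v

cons-⊆ᵛ : ∀ {n} {G : VertexSet (suc n)} {b H} → (T b → T (G fzero)) → H ⊆ᵛ (G ∘ fsuc) → cons b H ⊆ᵛ G
cons-⊆ᵛ head tail fzero    = head
cons-⊆ᵛ head tail (fsuc v) = tail v

-- If the
-- first vertex lies in G but not in F, it is included only when the others cannot reach r,
-- in which case H = G has exactly r elements.
sandwich : ∀ {n} (F G : VertexSet n) → F ⊆ᵛ G → ∀ r → count F ≤ r → r ≤ count G → Sandwiched F G r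
sandwich F G F⊆G zero F≤0 _ = F , ⊆ᵛ-refl , F⊆G , n≤0⇒n≡0 F≤0
sandwich {suc n} F G F⊆G (suc r) F≤r r≤G with F fzero in f₀ | G fzero in g₀
... | true | true
  = let H , F′⊆H , H⊆G′ , |H| = sandwich (F ∘ fsuc) (G ∘ fsuc) (F⊆G ∘ fsuc) r (≤-pred F≤r) (≤-pred r≤G) in
    cons true H , ⊆ᵛ-cons (λ _ → tt) F′⊆H , cons-⊆ᵛ (λ _ → T-true g₀) H⊆G′ , cong suc |H|
... | false | false
  = let H , F′⊆H , H⊆G′ , |H| = sandwich (F ∘ fsuc) (G ∘ fsuc) (F⊆G ∘ fsuc) (suc r) F≤r r≤G in
    cons false H , ⊆ᵛ-cons (subst T f₀) F′⊆H , cons-⊆ᵛ (λ ()) H⊆G′ , |H|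
... | true | false = ⊥-elim (¬T-false g₀ (F⊆G fzero (T-true f₀)))
... | false | true with suc r ≤? count (G ∘ fsuc)
...   | yes r≤G′
  = let H , F′⊆H , H⊆G′ , |H| = sandwich (F ∘ fsuc) (G ∘ fsuc) (F⊆G ∘ fsuc) (suc r) F≤r r≤G′ in
    cons false H , ⊆ᵛ-cons (subst T f₀) F′⊆H , cons-⊆ᵛ (λ ()) H⊆G′ , |H|
...   | no r≰G′
  = G , F⊆G , ⊆ᵛ-refl , trans (count-head G g₀) (cong suc (≤-antisym (≤-pred (≰⇒> r≰G′)) (≤-pred r≤G)))

module _ {a p q} {X : Set a} {P : Pred X p} {Q : Pred X q} (P? : Decidable P) (Q? : Decidable Q) where

  length-filter-mono : ∀ xs → (∀ {x} → x ∈ xs → P x → Q x) →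
                       length (filter P? xs) ≤ length (filter Q? xs)
  length-filter-mono []       P⇒Q = z≤n
  length-filter-mono (x ∷ xs) P⇒Q with P? x | Q? x
  ... | yes _  | yes _  = s≤s (length-filter-mono xs (P⇒Q ∘ there))
  ... | yes px | no ¬qx = contradiction (P⇒Q (here refl) px) ¬qx
  ... | no _   | yes _  = m≤n⇒m≤1+n (length-filter-mono xs (P⇒Q ∘ there))
  ... | no _   | no _   = length-filter-mono xs (P⇒Q ∘ there)

  length-filter-near : ∀ {xs} y → Unique xs → (∀ {x} → x ∈ xs → P x → Q x ⊎ x ≡ y) →
                       length (filter P? xs) ≤ suc (length (filter Q? xs))
  length-filter-near y [] _ = z≤n
  length-filter-near {x ∷ xs} y (x∉xs ∷ unique) P⇒Q∨y with P? x | Q? x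
  ... | yes _  | yes _  = s≤s (length-filter-near y unique (P⇒Q∨y ∘ there))
  ... | no _   | yes _  = m≤n⇒m≤1+n (length-filter-near y unique (P⇒Q∨y ∘ there))
  ... | no _   | no _   = length-filter-near y unique (P⇒Q∨y ∘ there)
  ... | yes px | no ¬qx = s≤s (length-filter-mono xs P⇒Q)
    where
    x≡y : x ≡ y
    x≡y = [ (λ qx → contradiction qx ¬qx) , id ]′ (P⇒Q∨y (here refl) px)
    P⇒Q : ∀ {c} → c ∈ xs → P c → Q c
    P⇒Q c∈xs pc = [ id , (λ c≡y → contradiction (trans x≡y (sym c≡y)) (All.lookup x∉xs c∈xs)) ]′
                    (P⇒Q∨y (there c∈xs) pc)

length-filter-∁ : ∀ {a p} {X : Set a} {P : Pred X p} (P? : Decidable P) xs →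
                  length (filter P? xs) + length (filter (∁? P?) xs) ≡ length xs
length-filter-∁ P? []       = refl
length-filter-∁ P? (x ∷ xs) with P? x
... | yes _ = cong suc (length-filter-∁ P? xs)
... | no _  = trans (+-suc _ _) (cong suc (length-filter-∁ P? xs))

below above : ℕ → List ℕ → List ℕ
below t = filter (_<? t)
above t = filter (∁? (_<? t))

#below : ℕ → List ℕ → ℕ
#below t L = length (below t L)

#below+above : ∀ t L → #below t L + length (above t L) ≡ length L
#below+above t = length-filter-∁ (_<? t)

#below-zero : ∀ L → #below 0 L ≡ 0
#below-zero []      = refl
#below-zero (_ ∷ L) = #below-zero L

#below-all : ∀ {t L} → All.All (_< t) L → #below t L ≡ length L
#below-all {t} all = cong length (filter-all (_<? t) all)

-- Raising the threshold by one admits at most the one colour t (lists have no repetitions).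
#below-step : ∀ t {L} → Unique L → #below (suc t) L ≤ suc (#below t L)
#below-step t unique = length-filter-near (_<? suc t) (_<? t) t unique (λ _ → m≤n⇒m<n∨m≡n ∘ ≤-pred)

∈-below⁻ : ∀ {c t} L → c ∈ below t L → c ∈ L × c < t
∈-below⁻ {t = t} L = ∈-filter⁻ (_<? t)

∈-above⁻ : ∀ {c t} L → c ∈ above t L → c ∈ L × ¬ c < t
∈-above⁻ {t = t} L = ∈-filter⁻ (∁? (_<? t))

∈⇒≤sum : ∀ {c L} → c ∈ L → c ≤ sum L
∈⇒≤sum (here refl)             = m≤m+n _ _
∈⇒≤sum {L = x ∷ _} (there c∈L) = ≤-trans (∈⇒≤sum c∈L) (m≤n+m _ x)

colourBound : ∀ {n} → (Fin n → List ℕ) → ℕ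
colourBound {n} S = suc (sum (map (sum ∘ S) (allFin n)))

<colourBound : ∀ {n} (S : Fin n → List ℕ) {v c} → c ∈ S v → c < colourBound S
<colourBound S {v} c∈Sv = s≤s (≤-trans (∈⇒≤sum c∈Sv) (∈⇒≤sum (∈-map⁺ (sum ∘ S) (∈-allFin v))))

crossing : ∀ (g : ℕ → ℕ) b N → b < g 0 → g N ≤ b → ∃ λ t → b < g t × g (suc t) ≤ b
crossing g b zero    b<g0 g0≤b = contradiction g0≤b (<⇒≱ b<g0)
crossing g b (suc N) b<g0 gN+1≤b with g N ≤? b
... | yes gN≤b = crossing g b N b<g0 gN≤b
... | no  gN≰b = N , ≰⇒> gN≰b , gN+1≤b

remainder-≤ : ∀ {x c k b} → b ≤ x → x + c ≤ k + b → c ≤ k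
remainder-≤ {x} {c} {k} {b} b≤x x+c≤k+b = +-cancelˡ-≤ b c k (begin
  b + c ≤⟨ +-monoˡ-≤ c b≤x ⟩
  x + c ≤⟨ x+c≤k+b ⟩
  k + b ≡⟨ +-comm k b ⟩
  b + k ∎)
  where open ≤-Reasoning

IsAssignmentOn : ∀ {n} → ℕ → VertexSet n → (Fin n → List ℕ) → Set
IsAssignmentOn s A S = ∀ v → T (A v) → Unique (S v) × length (S v) ≡ s

-- Splitting one block B at a colour threshold: the upper part U keeps colours ≥ threshold
-- (there are ≥ b of them, since at most k lie below), the lower part B ∖ U keeps colours
-- < threshold (there are ≥ k of them); |U| ≤ b and |B ∖ U| ≤ k.
record ThresholdSplit (k b : ℕ) {n} (B : VertexSet n) (S : Fin n → List ℕ) : Set where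
  field
    threshold  : ℕ
    upper      : VertexSet n
    upper⊆B    : upper ⊆ᵛ B
    #upper     : count upper ≤ b
    #lower     : count (B ∖ upper) ≤ k
    upper-few  : ∀ v → T (upper v) → #below threshold (S v) ≤ k
    lower-many : ∀ v → T (B v) → ¬ T (upper v) → k ≤ #below threshold (S v)

module _ (k b : ℕ) (1≤k : 1 ≤ k) {n} (B : VertexSet n) (S : Fin n → List ℕ)
         (S-ok : IsAssignmentOn (k + b) B S) (#B : count B ≤ k + b) where

  -- At threshold t, vertices with fewer than k colours below t must be upper;
  -- vertices with at most k colours below t may be upper.
  forced allowed : ℕ → VertexSet n
  forced  t v = B v ∧ (#below t (S v) <ᵇ k)
  allowed t v = B v ∧ (#below t (S v) ≤ᵇ k)

  forced⊆allowed : ∀ t → forced t ⊆ᵛ allowed t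
  forced⊆allowed t v h = let inB , few = ∧-elim h in ∧-intro inB (≤⇒≤ᵇ (<⇒≤ (<ᵇ⇒< _ k few)))

  split-at : ∀ t (U : VertexSet n) → forced t ⊆ᵛ U → U ⊆ᵛ allowed t →
             count U ≤ b → count (B ∖ U) ≤ k → ThresholdSplit k b B S
  split-at t U F⊆U U⊆A #U #B∖U = record
    { threshold  = t
    ; upper      = U
    ; upper⊆B    = λ v → proj₁ ∘ ∧-elim ∘ U⊆A v
    ; #upper     = #U
    ; #lower     = #B∖U
    ; upper-few  = λ v → ≤ᵇ⇒≤ _ k ∘ proj₂ ∘ ∧-elim ∘ U⊆A v
    ; lower-many = λ v inB ¬u → ≮⇒≥ (λ few → ¬u (F⊆U v (∧-intro inB (<⇒<ᵇ few))))
    }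

  split-small : count B ≤ b → ThresholdSplit k b B S
  split-small #B≤b = split-at 0 B (λ v → proj₁ ∘ ∧-elim) B⊆allowed₀ #B≤b
                       (subst (_≤ k) (sym (count-none (B ∖ B) nothing-left)) z≤n)
    where
    B⊆allowed₀ : B ⊆ᵛ allowed 0
    B⊆allowed₀ v inB = ∧-intro inB (≤⇒≤ᵇ (subst (_≤ k) (sym (#below-zero (S v))) z≤n))
    nothing-left : ∀ v → ¬ T (B v ∧ not (B v))
    nothing-left v h = let inB , notB = ∧-elim {B v} h in not-elim notB inB

  forced-at-start : count B ≤ count (forced 0)
  forced-at-start = count-mono B (forced 0) λ v inB →
    ∧-intro inB (<⇒<ᵇ (subst (_< k) (sym (#below-zero (S v))) 1≤k))

  forced-at-end : count (forced (colourBound S)) ≡ 0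
  forced-at-end = count-none (forced (colourBound S)) λ v h →
    let inB , few = ∧-elim h in <⇒≱ (<ᵇ⇒< _ k few) (begin
      k                             ≤⟨ m≤m+n k b ⟩
      k + b                         ≡⟨ sym (proj₂ (S-ok v inB)) ⟩
      length (S v)                  ≡⟨ sym (#below-all (All.tabulate (<colourBound S))) ⟩
      #below (colourBound S) (S v)  ∎)
    where open ≤-Reasoning

  -- A vertex not allowed at t + 1 has more than k colours ≤ t, hence at least k below t.
  overfull⊆unforced : ∀ t → (B ∖ allowed (suc t)) ⊆ᵛ (B ∖ forced t)
  overfull⊆unforced t v h =
    let inB , overfull = ∧-elim {B v} h
        step : #below (suc t) (S v) ≤ suc (#below t (S v))
        step = #below-step t (proj₁ (S-ok v inB))
    in ∧-intro inB (not-intro λ forcedᵥ →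
         not-elim overfull (∧-intro inB (≤⇒≤ᵇ (≤-trans step (<ᵇ⇒< _ k (proj₂ (∧-elim forcedᵥ)))))))

  -- Just after the number of forced vertices drops to at most b, split at t + 1: take b upper
  -- vertices between forced and allowed if there are enough allowed ones, all allowed ones otherwise.
  split-after-crossing : ∀ t → b < count (forced t) → count (forced (suc t)) ≤ b → ThresholdSplit k b B S
  split-after-crossing t b<forced forced′≤b with b ≤? count (allowed (suc t))
  ... | yes b≤allowed =
    let U , F⊆U , U⊆A , #U≡b = sandwich (forced (suc t)) (allowed (suc t)) (forced⊆allowed (suc t))
                                        b forced′≤b b≤allowed
        U⊆B : U ⊆ᵛ B
        U⊆B v = proj₁ ∘ ∧-elim ∘ U⊆A v
    in split-at (suc t) U F⊆U U⊆A (≤-reflexive #U≡b)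
         (remainder-≤ (≤-reflexive (sym #U≡b)) (≤-trans (count-complement U B U⊆B) #B))
  ... | no b≰allowed =
    split-at (suc t) (allowed (suc t)) (forced⊆allowed (suc t)) ⊆ᵛ-refl (<⇒≤ (≰⇒> b≰allowed))
      (≤-trans (count-mono _ _ (overfull⊆unforced t)) #unforced)
    where
    #unforced : count (B ∖ forced t) ≤ k
    #unforced = remainder-≤ (<⇒≤ b<forced)
                  (≤-trans (count-complement (forced t) B (λ v → proj₁ ∘ ∧-elim)) #B)

  thresholdSplit : ThresholdSplit k b B S
  thresholdSplit with count B ≤? b
  ... | yes #B≤b = split-small #B≤b
  ... | no  #B≰b =
    let t , b<forced , forced′≤b = crossing (count ∘ forced) b (colourBound S)
                                     (<-≤-trans (≰⇒> #B≰b) forced-at-start)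
                                     (subst (_≤ b) (sym forced-at-end) z≤n)
    in split-after-crossing t b<forced forced′≤b

blockSize : ∀ {n} → VertexSet n → (Fin n → ℕ) → ℕ → ℕ
blockSize A p i = count (λ v → A v ∧ (p v ≡ᵇ i))

record Refinement (k : ℕ) {n} (A : VertexSet n) (p : Fin n → ℕ) (S : Fin n → List ℕ) : Set where
  field
    label        : Fin n → ℕ
    sublist      : Fin n → List ℕ
    sublist-ok   : IsAssignmentOn k A sublist
    sublist-⊆    : ∀ v → T (A v) → sublist v ⊆ˡ S v
    small-blocks : ∀ i → blockSize A label i ≤ k
    separated    : ∀ {u v} → T (A u) → T (A v) → p u ≡ p v → label u ≢ label v →
                   Disjoint (sublist u) (sublist v)

-- Labels 2q and 2q + 1 keep the two parts of a peeling step apart.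
even-or-odd : ∀ i → ∃ λ q → i ≡ 2 * q ⊎ i ≡ suc (2 * q)
even-or-odd zero = 0 , inj₁ refl
even-or-odd (suc i) with even-or-odd i
... | q , inj₁ i≡2q   = q , inj₂ (cong suc i≡2q)
... | q , inj₂ i≡2q+1 = suc q , inj₁ (trans (cong suc i≡2q+1) (sym (*-suc 2 q)))

∈-take⁻ : ∀ {c} r (L : List ℕ) → c ∈ take r L → c ∈ L
∈-take⁻ r L = Sublist.lookup (take-⊆ r L)

take-length : ∀ r (L : List ℕ) → r ≤ length L → length (take r L) ≡ r
take-length r L r≤L = trans (length-take r L) (m≤n⇒m⊓n≡m r≤L)

module Peel (k b : ℕ) (1≤k : 1 ≤ k) {n} (A : VertexSet n) (p : Fin n → ℕ) (S : Fin n → List ℕ)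
            (S-ok : IsAssignmentOn (k + b) A S) (#blocks : ∀ i → blockSize A p i ≤ k + b) where

  open ThresholdSplit

  inBlock : ℕ → VertexSet n
  inBlock i v = A v ∧ (p v ≡ᵇ i)

  inOwnBlock : ∀ {v} → T (A v) → T (inBlock (p v) v)
  inOwnBlock {v} a = ∧-intro a (≡⇒≡ᵇ (p v) (p v) refl)

  splitBlock : ∀ i → ThresholdSplit k b (inBlock i) S
  splitBlock i = thresholdSplit k b 1≤k (inBlock i) S (λ v → S-ok v ∘ proj₁ ∘ ∧-elim) (#blocks i)

  θ : Fin n → ℕ
  θ v = threshold (splitBlock (p v))

  rest : VertexSet n
  rest v = upper (splitBlock (p v)) v

  restList lowList : Fin n → List ℕ
  restList v = take b (above (θ v) (S v))
  lowList  v = take k (below (θ v) (S v))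

  rest⊆A : rest ⊆ᵛ A
  rest⊆A v = proj₁ ∘ ∧-elim ∘ upper⊆B (splitBlock (p v)) v

  restList-ok : IsAssignmentOn b rest restList
  restList-ok v r = Unique.take⁺ b (Unique.filter⁺ _ (proj₁ (S-ok v a))) , take-length b _ b≤above
    where
    a : T (A v)
    a = rest⊆A v r
    b≤above : b ≤ length (above (θ v) (S v))
    b≤above = +-cancelˡ-≤ k b _ (begin
      k + b                                            ≡⟨ sym (proj₂ (S-ok v a)) ⟩
      length (S v)                                     ≡⟨ sym (#below+above (θ v) (S v)) ⟩
      #below (θ v) (S v) + length (above (θ v) (S v))  ≤⟨ +-monoˡ-≤ _ (upper-few (splitBlock (p v)) v r) ⟩
      k + length (above (θ v) (S v))                   ∎)
      where open ≤-Reasoning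

  rest-blocks : ∀ i → blockSize rest p i ≤ b
  rest-blocks i = ≤-trans (count-mono _ _ rest-in-block) (#upper (splitBlock i))
    where
    rest-in-block : ∀ v → T (rest v ∧ (p v ≡ᵇ i)) → T (upper (splitBlock i) v)
    rest-in-block v h = let r , e = ∧-elim {rest v} h in
      subst (λ j → T (upper (splitBlock j) v)) (≡ᵇ⇒≡ (p v) i e) r

  lowList-ok : ∀ v → T (A v) → ¬ T (rest v) → Unique (lowList v) × length (lowList v) ≡ k
  lowList-ok v a ¬r = Unique.take⁺ k (Unique.filter⁺ _ (proj₁ (S-ok v a))) ,
                      take-length k _ (lower-many (splitBlock (p v)) v (inOwnBlock a) ¬r)

  restList-⊆ : ∀ v → restList v ⊆ˡ S v
  restList-⊆ v = proj₁ ∘ ∈-above⁻ (S v) ∘ ∈-take⁻ b _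

  lowList-⊆ : ∀ v → lowList v ⊆ˡ S v
  lowList-⊆ v = proj₁ ∘ ∈-below⁻ (S v) ∘ ∈-take⁻ k _

  -- In a common block both lists are cut at the same threshold, from opposite sides.
  rest-low-disjoint : ∀ {u v} → p u ≡ p v → Disjoint (restList u) (lowList v)
  rest-low-disjoint {u} {v} pu≡pv {c} (c∈u , c∈v) =
    c≮θu (subst (λ j → c < threshold (splitBlock j)) (sym pu≡pv) c<θv)
    where
    c≮θu : ¬ c < θ u
    c≮θu = proj₂ (∈-above⁻ (S u) (∈-take⁻ b _ c∈u))
    c<θv : c < θ v
    c<θv = proj₂ (∈-below⁻ (S v) (∈-take⁻ k _ c∈v))

  extend : Refinement k rest p restList → Refinement k A p S
  extend R = record
    { label        = label
    ; sublist      = sublist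
    ; sublist-ok   = sublist-ok
    ; sublist-⊆    = sublist-⊆
    ; small-blocks = small-blocks
    ; separated    = separated
    }
    where
    module R = Refinement R

    label : Fin n → ℕ
    label v = if rest v then suc (2 * R.label v) else 2 * p v

    sublist : Fin n → List ℕ
    sublist v = if rest v then R.sublist v else lowList v

    sublist-ok : IsAssignmentOn k A sublist
    sublist-ok v a with rest v in e
    ... | true  = R.sublist-ok v (T-true e)
    ... | false = lowList-ok v a (¬T-false e)

    sublist-⊆ : ∀ v → T (A v) → sublist v ⊆ˡ S v
    sublist-⊆ v a with rest v in e
    ... | true  = restList-⊆ v ∘ R.sublist-⊆ v (T-true e)
    ... | false = lowList-⊆ v

    lower-part : ∀ q v → T (A v ∧ (label v ≡ᵇ 2 * q)) → T ((inBlock q ∖ upper (splitBlock q)) v)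
    lower-part q v h with rest v in e | ∧-elim {A v} h
    ... | true  | _ , l = contradiction (sym (≡ᵇ⇒≡ _ _ l)) (even≢odd q (R.label v))
    ... | false | a , l = ∧-intro (∧-intro a (≡⇒≡ᵇ _ _ pv≡q))
                                  (not-intro (¬T-false e ∘ subst (λ j → T (upper (splitBlock j) v)) (sym pv≡q)))
      where
      pv≡q : p v ≡ q
      pv≡q = *-cancelˡ-≡ (p v) q 2 (≡ᵇ⇒≡ _ _ l)

    rest-part : ∀ q v → T (A v ∧ (label v ≡ᵇ suc (2 * q))) → T (rest v ∧ (R.label v ≡ᵇ q))
    rest-part q v h with rest v in e | ∧-elim {A v} h
    ... | true  | _ , l = ≡⇒≡ᵇ _ _ (*-cancelˡ-≡ (R.label v) q 2 (suc-injective (≡ᵇ⇒≡ _ _ l)))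
    ... | false | _ , l = contradiction (≡ᵇ⇒≡ _ _ l) (even≢odd (p v) q)

    small-blocks : ∀ i → blockSize A label i ≤ k
    small-blocks i with even-or-odd i
    ... | q , inj₁ refl = ≤-trans (count-mono _ _ (lower-part q)) (#lower (splitBlock q))
    ... | q , inj₂ refl = ≤-trans (count-mono _ _ (rest-part q)) (R.small-blocks q)

    separated : ∀ {u v} → T (A u) → T (A v) → p u ≡ p v → label u ≢ label v →
                Disjoint (sublist u) (sublist v)
    separated {u} {v} _ _ pu≡pv lu≢lv with rest u in eu | rest v in ev
    ... | true  | true  = R.separated (T-true eu) (T-true ev) pu≡pv (lu≢lv ∘ cong (suc ∘ (2 *_)))
    ... | false | false = contradiction (cong (2 *_) pu≡pv) lu≢lv
    ... | true  | false = λ (c∈u , c∈v) → rest-low-disjoint pu≡pv (R.sublist-⊆ u (T-true eu) c∈u , c∈v)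
    ... | false | true  = λ (c∈u , c∈v) → rest-low-disjoint (sym pu≡pv) (R.sublist-⊆ v (T-true ev) c∈v , c∈u)

refine : ∀ k → 1 ≤ k → ∀ m {n} (A : VertexSet n) (p : Fin n → ℕ) (S : Fin n → List ℕ) →
         IsAssignmentOn (suc m * k) A S → (∀ i → blockSize A p i ≤ suc m * k) → Refinement k A p S
refine k 1≤k zero A p S S-ok #blocks = record
  { label        = p
  ; sublist      = S
  ; sublist-ok   = λ v a → let unique , length≡ = S-ok v a in unique , trans length≡ (+-identityʳ k)
  ; sublist-⊆    = λ _ _ c∈S → c∈S
  ; small-blocks = λ i → subst (blockSize A p i ≤_) (+-identityʳ k) (#blocks i)
  ; separated    = λ _ _ pu≡pv pu≢pv → contradiction pu≡pv pu≢pv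
  }
refine k 1≤k (suc m) A p S S-ok #blocks = extend (refine k 1≤k m rest p restList restList-ok rest-blocks)
  where open Peel k (suc m * k) 1≤k A p S S-ok #blocks

allVertices : ∀ {n} → VertexSet n
allVertices _ = true

blockSize-allVertices : ∀ {n} (p : Fin n → ℕ) i →
                        length (filter (λ v → p v ≟ i) (allFin n)) ≡ blockSize allVertices p i
blockSize-allVertices p i = count-tabulate (λ v → p v ≟ i) id

-- A refinement turns strong k-choosability into a colouring of G + cliques(p) from S:
-- colour G + cliques(label) from the sublists; an added edge inside a p-block but across
-- label-blocks joins vertices with disjoint sublists.
colour-via-refinement : ∀ {n} (G : Graph n) k → StronglyChoosable G k → ∀ p S →
                        Refinement k allVertices p S → Σ (Fin n → ℕ) (ProperListColouring (AddCliques G p) S)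
colour-via-refinement {n} G k strongly p S R = c , (λ v → sublist-⊆ v tt (c∈ v)) , proper
  where
  open Refinement R
  colouring : Σ (Fin n → ℕ) (ProperListColouring (AddCliques G label) sublist)
  colouring = strongly label (λ i → subst (_≤ k) (sym (blockSize-allVertices label i)) (small-blocks i))
                       sublist (λ v → sublist-ok v tt)
  c : Fin n → ℕ
  c = proj₁ colouring
  c∈ : ∀ v → c v ∈ sublist v
  c∈ = proj₁ (proj₂ colouring)
  proper′ : ∀ u v → AddCliques G label u v → c u ≢ c v
  proper′ = proj₂ (proj₂ colouring)
  proper : ∀ u v → AddCliques G p u v → c u ≢ c v
  proper u v (inj₁ uv∈G) = proper′ u v (inj₁ uv∈G)
  proper u v (inj₂ (u≢v , pu≡pv)) with label u ≟ label v
  ... | yes lu≡lv = proper′ u v (inj₂ (u≢v , lu≡lv))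
  ... | no  lu≢lv = λ cu≡cv → separated tt tt pu≡pv lu≢lv (c∈ u , subst (_∈ sublist v) (sym cu≡cv) (c∈ v))

theorem7p2 : ∀ (k m : ℕ) → NonZero k → NonZero m → ∀ {n} (G : Graph n) →
    StronglyChoosable G k → StronglyChoosable G (k * m)
theorem7p2 k zero    _   ()
theorem7p2 k (suc m) k≢0 _  G strongly p blocks S S-ok =
  colour-via-refinement G k strongly p S (refine k (>-nonZero⁻¹ k {{k≢0}}) m allVertices p S S-ok′ blocks′)
  where
  km≡ : k * suc m ≡ suc m * k
  km≡ = *-comm k (suc m)
  S-ok′ : IsAssignmentOn (suc m * k) allVertices S
  S-ok′ v _ = let unique , length≡ = S-ok v in unique , trans length≡ km≡
  blocks′ : ∀ i → blockSize allVertices p i ≤ suc m * k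
  blocks′ i = subst₂ _≤_ (blockSize-allVertices p i) km≡ (blocks i)
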